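{- Let $\sigma$ and $\sigma'$ be non-null signatures each having exactly $k$ minus signs and $k+s$ plus signs (for integers $k \ge 0$, $s$ with $k+s \ge 0$). Then the heady minimum-length sequences of $\sigma$ and $\sigma'$ have the same length. If moreover both $\sigma$ and $\sigma'$ end with a minus sign, then their taily minimum-length sequences have the same length. Thus the length of the minimum-length sequence depends only on $k$, $s$, and whether it is heady or taily.
   Context: For a binary sequence $x = (x_1,\dots,x_n)$, its signature $\sigma(x)$ is the word over $\{+,-\}$ obtained by scanning $i = 1,\dots,n-1$ in order and writing $+$ whenever $(x_i,x_{i+1}) = (1,1)$ and $-$ whenever $(x_i,x_{i+1}) = (1,0)$ (pairs $(0,1)$, $(0,0)$ contribute nothing). A signature is non-null if it is a nonempty word. For a signature $\sigma$, its heady minimum-length sequence is the shortest binary sequence whose last entry is $1$ and whose signature is $\sigma$ (it starts with 1, contains each 1 followed by a 1 for a $+$ and by a 0 for a $-$, every 0 is followed by a 1 or ends the sequence, and a final 1 is appended after a terminal $-$); for $\sigma$ ending with $-$, its taily minimum-length sequence is the shortest binary sequence whose last entry is $0$ and whose signature is $\sigma$. -}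

module Defs where

open import Data.Bool using (Bool; true; false)
open import Data.Nat using (ℕ; zero; suc; _≤_)
open import Data.List using (List; []; _∷_; length; last)
open import Data.Maybe using (Maybe; just)
open import Data.Product using (_×_)
open import Relation.Binary.PropositionalEquality using (_≡_)
open import Relation.Nullary using (¬_)

data Sign : Set where
  plus minus : Sign

Signature : Set
Signature = List Sign

-- Binary sequences: true = 1, false = 0.
BinSeq : Set
BinSeq = List Bool

sig : BinSeq → Signature
sig [] = []
sig (b ∷ []) = []
sig (true ∷ true ∷ xs) = plus ∷ sig (true ∷ xs)
sig (true ∷ false ∷ xs) = minus ∷ sig (false ∷ xs)
sig (false ∷ y ∷ xs) = sig (y ∷ xs)

NonNull : Signature → Set
NonNull σ = ¬ (σ ≡ [])

countPlus : Signature → ℕ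
countPlus [] = zero
countPlus (plus ∷ σ) = suc (countPlus σ)
countPlus (minus ∷ σ) = countPlus σ

countMinus : Signature → ℕ
countMinus [] = zero
countMinus (plus ∷ σ) = countMinus σ
countMinus (minus ∷ σ) = suc (countMinus σ)

EndsWithMinus : Signature → Set
EndsWithMinus σ = last σ ≡ just minus

Heady : Signature → BinSeq → Set
Heady σ x = (last x ≡ just true) × (sig x ≡ σ)

Taily : Signature → BinSeq → Set
Taily σ x = (last x ≡ just false) × (sig x ≡ σ)

IsShortest : (BinSeq → Set) → BinSeq → Set
IsShortest P x = P x × ((y : BinSeq) → P y → length x ≤ length y)

HeadyMin : Signature → BinSeq → Set
HeadyMin σ = IsShortest (Heady σ)

TailyMin : Signature → BinSeq → Set
TailyMin σ = IsShortest (Taily σ)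

{-# OPTIONS --safe #-}
-- Charge each sign of σ(x) to the 1 it is read off, and each − also to its 0: these
-- positions are distinct, so |x| ≥ w(σ) := #+ + 2·#−, and the last entry is uncharged when
-- it is 1, so then |x| > w(σ). The sequence 1 followed by a block 1 for each + and 01 for
-- each − has signature σ and length w(σ) + 1; for σ = τ− dropping its final 1 leaves a
-- taily sequence of length w(σ). So the minimal lengths are w(σ) + 1 and w(σ), which
-- depend only on the two sign counts.
module Submission where

open import Defs
open import Data.Bool using (true; false)
open import Data.Integer using (ℤ; +_; _+_; _≤_)
open import Data.Integer.Properties using (+-injective)
open import Data.List using (List; []; _∷_; _++_; _∷ʳ_; length; last; map)
open import Data.List.Properties using (++-identityʳ; length-++; map-++)
open import Data.Maybe using (just)
open import Data.Nat as ℕ using (ℕ; suc; _*_; z≤n; s≤s)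
open import Data.Nat.ListAction using (sum)
open import Data.Nat.ListAction.Properties using (sum-++)
open import Data.Nat.Properties using (≤-antisym; ≤-reflexive; ≤-trans; m≤n⇒m≤1+n; +-suc)
open import Data.Nat.Tactic.RingSolver using (solve-∀)
open import Data.Product using (_×_; _,_; ∃)
open import Relation.Binary.PropositionalEquality
  using (_≡_; refl; sym; trans; cong; cong₂; module ≡-Reasoning)

open ≡-Reasoning

last-∷ʳ : ∀ {A : Set} (xs : List A) x → last (xs ∷ʳ x) ≡ just x
last-∷ʳ []           x = refl
last-∷ʳ (_ ∷ [])     x = refl
last-∷ʳ (_ ∷ y ∷ ys) x = last-∷ʳ (y ∷ ys) x

last≡just⇒∷ʳ : ∀ {A : Set} (xs : List A) {x} → last xs ≡ just x → ∃ λ ys → xs ≡ ys ∷ʳ x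
last≡just⇒∷ʳ (y ∷ [])     refl = [] , refl
last≡just⇒∷ʳ (y ∷ z ∷ zs) eq with last≡just⇒∷ʳ (z ∷ zs) eq
... | ys , zs≡ys∷ʳx = y ∷ ys , cong (y ∷_) zs≡ys∷ʳx

shortest-length-unique : ∀ {P} x y → IsShortest P x → IsShortest P y → length x ≡ length y
shortest-length-unique _ _ (px , x-min) (py , y-min) = ≤-antisym (x-min _ py) (y-min _ px)

signWeight : Sign → ℕ
signWeight plus  = 1
signWeight minus = 2

weight : Signature → ℕ
weight σ = sum (map signWeight σ)

weight-++ : ∀ σ τ → weight (σ ++ τ) ≡ weight σ ℕ.+ weight τ
weight-++ σ τ = trans (cong sum (map-++ signWeight σ τ)) (sum-++ (map signWeight σ) _)

weight≡countPlus+2*countMinus : ∀ σ → weight σ ≡ countPlus σ ℕ.+ 2 * countMinus σ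
weight≡countPlus+2*countMinus []          = refl
weight≡countPlus+2*countMinus (plus ∷ σ)  = cong suc (weight≡countPlus+2*countMinus σ)
weight≡countPlus+2*countMinus (minus ∷ σ) = begin
  2 ℕ.+ weight σ                          ≡⟨ cong (2 ℕ.+_) (weight≡countPlus+2*countMinus σ) ⟩
  2 ℕ.+ (countPlus σ ℕ.+ 2 * countMinus σ) ≡⟨ shift (countPlus σ) (countMinus σ) ⟩
  countPlus σ ℕ.+ 2 * suc (countMinus σ)  ∎
  where
  shift : ∀ p m → 2 ℕ.+ (p ℕ.+ 2 * m) ≡ p ℕ.+ 2 * suc m
  shift = solve-∀

weight-sig≤length : ∀ x → weight (sig x) ℕ.≤ length x
weight-sig≤length []                      = z≤n
weight-sig≤length (_ ∷ [])                = z≤n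
weight-sig≤length (true ∷ true ∷ xs)      = s≤s (weight-sig≤length (true ∷ xs))
weight-sig≤length (true ∷ false ∷ [])     = s≤s (s≤s z≤n)
weight-sig≤length (true ∷ false ∷ y ∷ ys) = s≤s (s≤s (weight-sig≤length (y ∷ ys)))
weight-sig≤length (false ∷ y ∷ ys)        = m≤n⇒m≤1+n (weight-sig≤length (y ∷ ys))

weight-sig<length : ∀ x → last x ≡ just true → weight (sig x) ℕ.< length x
weight-sig<length (true ∷ [])             _  = s≤s z≤n
weight-sig<length (true ∷ true ∷ xs)      eq = s≤s (weight-sig<length (true ∷ xs) eq)
weight-sig<length (true ∷ false ∷ y ∷ ys) eq = s≤s (s≤s (weight-sig<length (y ∷ ys) eq))
weight-sig<length (false ∷ y ∷ ys)        eq = m≤n⇒m≤1+n (weight-sig<length (y ∷ ys) eq)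

blocks : Signature → BinSeq
blocks []          = []
blocks (plus ∷ σ)  = true ∷ blocks σ
blocks (minus ∷ σ) = false ∷ true ∷ blocks σ

length-blocks : ∀ σ → length (blocks σ) ≡ weight σ
length-blocks []          = refl
length-blocks (plus ∷ σ)  = cong suc (length-blocks σ)
length-blocks (minus ∷ σ) = cong (2 ℕ.+_) (length-blocks σ)

last-1∷blocks : ∀ σ → last (true ∷ blocks σ) ≡ just true
last-1∷blocks []          = refl
last-1∷blocks (plus ∷ σ)  = last-1∷blocks σ
last-1∷blocks (minus ∷ σ) = last-1∷blocks σ

sig-1∷blocks-++ : ∀ σ ys → sig (true ∷ blocks σ ++ ys) ≡ σ ++ sig (true ∷ ys)
sig-1∷blocks-++ []          ys = refl
sig-1∷blocks-++ (plus ∷ σ)  ys = cong (plus ∷_) (sig-1∷blocks-++ σ ys)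
sig-1∷blocks-++ (minus ∷ σ) ys = cong (minus ∷_) (sig-1∷blocks-++ σ ys)

headyMin-1∷blocks : ∀ σ → HeadyMin σ (true ∷ blocks σ)
headyMin-1∷blocks σ = (last-1∷blocks σ , sig-1∷blocks) , shortest
  where
  sig-1∷blocks : sig (true ∷ blocks σ) ≡ σ
  sig-1∷blocks = begin
    sig (true ∷ blocks σ)      ≡⟨ cong (λ xs → sig (true ∷ xs)) (sym (++-identityʳ (blocks σ))) ⟩
    sig (true ∷ blocks σ ++ []) ≡⟨ sig-1∷blocks-++ σ [] ⟩
    σ ++ []                    ≡⟨ ++-identityʳ σ ⟩
    σ                          ∎

  shortest : ∀ y → Heady σ y → suc (length (blocks σ)) ℕ.≤ length y
  shortest y (last-y , refl) =
    ≤-trans (s≤s (≤-reflexive (length-blocks σ))) (weight-sig<length y last-y)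

length-1∷blocks∷ʳ0 : ∀ τ → length (true ∷ blocks τ ∷ʳ false) ≡ weight (τ ∷ʳ minus)
length-1∷blocks∷ʳ0 τ = begin
  suc (length (blocks τ ∷ʳ false)) ≡⟨ cong suc (length-++ (blocks τ)) ⟩
  suc (length (blocks τ) ℕ.+ 1)    ≡⟨ sym (+-suc (length (blocks τ)) 1) ⟩
  length (blocks τ) ℕ.+ 2          ≡⟨ cong (ℕ._+ 2) (length-blocks τ) ⟩
  weight τ ℕ.+ 2                   ≡⟨ sym (weight-++ τ (minus ∷ [])) ⟩
  weight (τ ∷ʳ minus)              ∎

tailyMin-1∷blocks∷ʳ0 : ∀ τ → TailyMin (τ ∷ʳ minus) (true ∷ blocks τ ∷ʳ false)
tailyMin-1∷blocks∷ʳ0 τ = (last-∷ʳ (true ∷ blocks τ) false , sig-1∷blocks-++ τ (false ∷ [])) , shortest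
  where
  shortest : ∀ y → Taily (τ ∷ʳ minus) y → length (true ∷ blocks τ ∷ʳ false) ℕ.≤ length y
  shortest y (_ , sig-y) = ≤-trans
    (≤-reflexive (trans (length-1∷blocks∷ʳ0 τ) (cong weight (sym sig-y))))
    (weight-sig≤length y)

headyMin-length : ∀ σ x → HeadyMin σ x → length x ≡ suc (weight σ)
headyMin-length σ x x-min = trans
  (shortest-length-unique x (true ∷ blocks σ) x-min (headyMin-1∷blocks σ))
  (cong suc (length-blocks σ))

tailyMin-length : ∀ σ x → EndsWithMinus σ → TailyMin σ x → length x ≡ weight σ
tailyMin-length σ x ends-minus x-min with last≡just⇒∷ʳ σ ends-minus
... | τ , refl = trans
  (shortest-length-unique x (true ∷ blocks τ ∷ʳ false) x-min (tailyMin-1∷blocks∷ʳ0 τ))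
  (length-1∷blocks∷ʳ0 τ)

lemma3 : (k : ℕ) (s : ℤ) → + 0 ≤ + k + s →
    (σ σ' : Signature) → NonNull σ → NonNull σ' →
    countMinus σ ≡ k → + countPlus σ ≡ + k + s →
    countMinus σ' ≡ k → + countPlus σ' ≡ + k + s →
    ((x x' : BinSeq) → HeadyMin σ x → HeadyMin σ' x' → length x ≡ length x')
    × (EndsWithMinus σ → EndsWithMinus σ' →
       (x x' : BinSeq) → TailyMin σ x → TailyMin σ' x' → length x ≡ length x')
lemma3 k s _ σ σ' _ _ minus-σ plus-σ minus-σ' plus-σ' = heady , taily
  where
  same-weight : weight σ ≡ weight σ'
  same-weight = begin
    weight σ                            ≡⟨ weight≡countPlus+2*countMinus σ ⟩
    countPlus σ ℕ.+ 2 * countMinus σ    ≡⟨ cong₂ (λ p m → p ℕ.+ 2 * m)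
                                             (+-injective (trans plus-σ (sym plus-σ')))
                                             (trans minus-σ (sym minus-σ')) ⟩
    countPlus σ' ℕ.+ 2 * countMinus σ'  ≡⟨ weight≡countPlus+2*countMinus σ' ⟨
    weight σ'                           ∎

  heady : (x x' : BinSeq) → HeadyMin σ x → HeadyMin σ' x' → length x ≡ length x'
  heady x x' x-min x'-min = begin
    length x          ≡⟨ headyMin-length σ x x-min ⟩
    suc (weight σ)    ≡⟨ cong suc same-weight ⟩
    suc (weight σ')   ≡⟨ headyMin-length σ' x' x'-min ⟨
    length x'         ∎

  taily : EndsWithMinus σ → EndsWithMinus σ' →
          (x x' : BinSeq) → TailyMin σ x → TailyMin σ' x' → length x ≡ length x'
  taily ends ends' x x' x-min x'-min = begin
    length x    ≡⟨ tailyMin-length σ x ends x-min ⟩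
    weight σ    ≡⟨ same-weight ⟩
    weight σ'   ≡⟨ tailyMin-length σ' x' ends' x'-min ⟨
    length x'   ∎
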